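{- Let $(C,\cdot)$ be an HFP-code of length $4n$ and let $D_1\subseteq C$ be the set of codewords with a $0$ in the first coordinate. Then the triple $(C,D_1,\mathbf 1)$ is a right Hadamard group (with respect to the group $(C,\cdot)$), i.e. $|D_1\cap D_1x|=2n$ for every $x\in C\setminus\{\mathbf 0,\mathbf 1\}$ and $|D_1x\cap\{y,y\cdot\mathbf 1\}|=1$ for all $x,y\in C$.
   Context: Let $\mathbb{F}=\mathbb{Z}_2$. $\mathbf 0,\mathbf 1$ denote the all-zero and all-one vectors; for a permutation $\pi$ of $\{1,\dots,m\}$ and $v\in\mathbb{F}^m$, $\pi(v)=(v_{\pi^{ -1}(1)},\dots,v_{\pi^{ -1}(m)})$. A binary Hadamard matrix of order $4n$ is obtained from a $4n\times4n$ matrix with entries $\pm1$ and $HH^T=4nI$ by replacing $+1$ by $0$ and $-1$ by $1$; the binary Hadamard code it defines is the set of its rows together with their complements. A code $C\subseteq\mathbb{F}^m$ with $\mathbf 0\in C$ is propelinear if to each $x\in C$ a coordinate permutation $\pi_x$ is assigned such that for all $x,y\in C$: $x+\pi_x(y)\in C$ and $\pi_x\pi_y=\pi_{x+\pi_x(y)}$; then $x\cdot y:=x+\pi_x(y)$ makes $(C,\cdot)$ a group with identity $\mathbf 0$, and products like $D_1x$ are taken in this group. An HFP-code of length $4n$ is a propelinear code that is also a binary Hadamard code of length $4n$, with $\pi_{\mathbf 0}=\pi_{\mathbf 1}=\mathrm{id}$ and such that for every $a\in C\setminus\{\mathbf 0,\mathbf 1\}$, $\pi_a$ has no fixed coordinate.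 A right Hadamard group of order $8n$ is a triple $(G,D,u)$ with $G$ a group of order $8n$, $D\subseteq G$ of size $4n$, $u$ a central involution, such that $|D\cap Da|=2n$ for all $a\in G\setminus\langle u\rangle$ and $|Da\cap\{b,bu\}|=1$ for all $a,b\in G$ (equivalently, a left Hadamard group over the opposite group). -}

module Defs where

open import Data.Bool using (Bool; true; false; _xor_)
open import Data.Nat using (ℕ; zero; suc; NonZero) renaming (_*_ to _*ℕ_)
open import Data.Integer using (ℤ; +_; -[1+_]; _+_; _*_; 0ℤ; 1ℤ; -1ℤ)
open import Data.Fin using (Fin; zero; suc; _≟_)
open import Data.Fin.Permutation using (Permutation′; _⟨$⟩ʳ_; _⟨$⟩ˡ_)
open import Data.Vec using (Vec; replicate; zipWith; tabulate; lookup)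
open import Data.List using (List; length)
open import Data.List.Membership.Propositional using (_∈_)
open import Data.List.Relation.Unary.Unique.Propositional using (Unique)
open import Data.Product using (Σ; ∃; _×_; _,_)
open import Data.Sum using (_⊎_)
open import Function.Bundles using (_⇔_)
open import Relation.Nullary using (¬_; does)
open import Relation.Binary.PropositionalEquality using (_≡_; _≢_)

-- binary vectors of length m (elements of F^m, F = Z_2, with 0 = false, 1 = true)
BVec : ℕ → Set
BVec m = Vec Bool m

𝟎 : ∀ {m} → BVec m
𝟎 = replicate _ false

𝟏 : ∀ {m} → BVec m
𝟏 = replicate _ true

_⊕_ : ∀ {m} → BVec m → BVec m → BVec m
_⊕_ = zipWith _xor_

-- coordinate permutation action: π(v) = (v_{π⁻¹(1)}, …, v_{π⁻¹(m)})
act : ∀ {m} → Permutation′ m → BVec m → BVec m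
act π v = tabulate (λ i → lookup v (π ⟨$⟩ˡ i))

∑ : ∀ {m} → (Fin m → ℤ) → ℤ
∑ {zero} f = 0ℤ
∑ {suc m} f = f zero + ∑ (λ i → f (suc i))

IsHadamardMatrix : ∀ {m} → (Fin m → Fin m → ℤ) → Set
IsHadamardMatrix {m} H =
  (∀ i j → H i j ≡ 1ℤ ⊎ H i j ≡ -1ℤ) ×
  (∀ i j → ∑ (λ k → H i k * H j k) ≡ (if does (i ≟ j) then + m else 0ℤ))
  where open import Data.Bool using (if_then_else_)

toBit : ℤ → Bool
toBit (+ _) = false
toBit -[1+ _ ] = true

binRow : ∀ {m} → (Fin m → Fin m → ℤ) → Fin m → BVec m
binRow H i = tabulate (λ k → toBit (H i k))

IsBinaryHadamardCode : ∀ {m} → (BVec m → Set) → Set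
IsBinaryHadamardCode {m} C =
  Σ (Fin m → Fin m → ℤ) λ H → IsHadamardMatrix H ×
    (∀ v → C v ⇔ (∃ λ i → v ≡ binRow H i ⊎ v ≡ binRow H i ⊕ 𝟏))

mul : ∀ {m} → (BVec m → Permutation′ m) → BVec m → BVec m → BVec m
mul π x y = x ⊕ act (π x) y

record IsPropelinear {m} (C : BVec m → Set) (π : BVec m → Permutation′ m) : Set where
  field
    zero∈ : C 𝟎
    closed : ∀ {x y} → C x → C y → C (mul π x y)
    hom : ∀ {x y} → C x → C y → ∀ i → π x ⟨$⟩ʳ (π y ⟨$⟩ʳ i) ≡ π (mul π x y) ⟨$⟩ʳ i

record IsHFP {m} (C : BVec m → Set) (π : BVec m → Permutation′ m) : Set where
  field
    propelinear : IsPropelinear C π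
    hadamard : IsBinaryHadamardCode C
    π𝟎 : ∀ i → π 𝟎 ⟨$⟩ʳ i ≡ i
    π𝟏 : ∀ i → π 𝟏 ⟨$⟩ʳ i ≡ i
    fixedPointFree : ∀ {a} → C a → a ≢ 𝟎 → a ≢ 𝟏 → ∀ i → π a ⟨$⟩ʳ i ≢ i

HasSize : ∀ {A : Set} → (A → Set) → ℕ → Set
HasSize {A} P k = Σ (List A) λ xs → Unique xs × length xs ≡ k × (∀ a → a ∈ xs ⇔ P a)

first : ∀ n → {{NonZero n}} → Fin (4 *ℕ n)
first (suc k) = zero

D₁ : ∀ n → {{_ : NonZero n}} → (BVec (4 *ℕ n) → Set) → BVec (4 *ℕ n) → Set
D₁ n C z = C z × lookup z (first n) ≡ false

rightTranslate : ∀ {m} → (BVec m → Permutation′ m) → (BVec m → Set) → BVec m → BVec m → Set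
rightTranslate π S x z = ∃ λ s → S s × z ≡ mul π s x

-- The propelinear product makes C a group with identity 𝟎 in which 𝟏 is central:
-- 𝟏 · x = x · 𝟏 = x ⊕ 𝟏. Inverses exist because left multiplication by x permutes the m
-- complementary pairs {row i, row i ⊕ 𝟏} of the Hadamard code. A codeword z lies in D₁ x iff
-- z · x⁻¹ has first bit 0, and for z ∈ D₁ this bit is the entry of x⁻¹ at the coordinate π_z⁻¹(1).
-- Fixed-point freeness makes z ↦ π_z⁻¹(1) injective on D₁, and D₁ contains one word of each
-- complementary pair, so this is a bijection from D₁ onto the coordinates. Hence |D₁ ∩ D₁ x| is
-- the number of zeros of x⁻¹, which is 2n by the orthogonality of the rows of the Hadamard matrix.
-- Finally y · x⁻¹ and (y · 𝟏) · x⁻¹ = y · x⁻¹ ⊕ 𝟏 have different first bits, so exactly one of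
-- y and y · 𝟏 lies in D₁ x.
module Submission where

open import Defs
open import Data.Bool using (Bool; true; false; not; _xor_; if_then_else_)
open import Data.Bool.Properties using (xor-assoc; xor-comm; xor-identityʳ; xor-same; not-¬)
  renaming (_≟_ to _≟ᵇ_)
open import Data.Empty using (⊥-elim)
open import Data.Fin using (Fin; zero; suc)
open import Data.Fin.Properties using (any?; punchOut-injective; injective⇒≤; suc-injective)
  renaming (_≟_ to _≟ᶠ_)
open import Data.Fin.Permutation using (Permutation′; _⟨$⟩ʳ_; _⟨$⟩ˡ_; inverseˡ; inverseʳ)
open import Data.Integer using (ℤ; +_; -_; 0ℤ; 1ℤ; -1ℤ) renaming (_+_ to _+ℤ_; _*_ to _*ℤ_)
import Data.Integer.Properties as ℤ
open import Data.Integer.Tactic.RingSolver using (solve-∀)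
open import Data.List using ([]; _∷_; map)
open import Data.List.Properties using (length-map)
open import Data.List.Membership.Propositional.Properties using (∈-map⁺; ∈-map⁻)
open import Data.List.Relation.Unary.Any using (here; there)
import Data.List.Relation.Unary.All as All
import Data.List.Relation.Unary.AllPairs as AllPairs
import Data.List.Relation.Unary.Unique.Propositional.Properties as Unique
open import Data.Nat using (ℕ; zero; suc; _*_; _+_; NonZero)
open import Data.Nat.Properties using (1+n≰n; m+1+n≢m; *-cancelˡ-≡; *-assoc; +-identityʳ)
open import Data.Product using (∃; _×_; _,_; proj₁; proj₂)
open import Data.Sum using (_⊎_; inj₁; inj₂; [_,_]′)
open import Data.Vec using ([]; _∷_; replicate; lookup; count)
open import Data.Vec.Properties
  using ( lookup-zipWith; lookup-replicate; lookup∘tabulate; tabulate∘lookup; tabulate-cong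
        ; zipWith-assoc; zipWith-comm; zipWith-identityʳ; zipWith-replicate; ≡-dec)
open import Function using (_∘_; _⇔_; mk⇔; Equivalence)
open import Relation.Nullary using (¬_; Dec; yes; no; does)
open import Relation.Nullary.Decidable using (dec-false)
open import Relation.Binary.PropositionalEquality
  using (_≡_; _≢_; refl; sym; trans; cong; cong₂; subst; module ≡-Reasoning)

-- Finite cardinalities

module _ {A : Set} where

  HasSize-cong : ∀ {P Q : A → Set} {k} → (∀ a → P a ⇔ Q a) → HasSize P k → HasSize Q k
  HasSize-cong P⇔Q (xs , !xs , |xs| , ∈⇔P) =
    xs , !xs , |xs| , λ a → mk⇔ (to (P⇔Q a) ∘ to (∈⇔P a)) (from (∈⇔P a) ∘ from (P⇔Q a))
    where open Equivalence

  HasSize-≡ : ∀ (a : A) → HasSize (_≡ a) 1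
  HasSize-≡ a = a ∷ [] , All.[] AllPairs.∷ AllPairs.[] , refl ,
                λ b → mk⇔ (λ { (here b≡a) → b≡a ; (there ()) }) here

  HasSize-witness : ∀ {P : A → Set} a → P a → (∀ b → P b → b ≡ a) → HasSize P 1
  HasSize-witness {P} a Pa unique =
    HasSize-cong (λ b → mk⇔ (λ b≡a → subst P (sym b≡a) Pa) (unique b)) (HasSize-≡ a)

  HasSize-∷ : ∀ {P : A → Set} {k a} → ¬ P a → HasSize P k → HasSize (λ b → b ≡ a ⊎ P b) (suc k)
  HasSize-∷ {P} {a = a} ¬Pa (xs , !xs , |xs| , ∈⇔P) =
    a ∷ xs , All.tabulate (λ b∈xs a≡b → ¬Pa (subst P (sym a≡b) (to (∈⇔P _) b∈xs))) AllPairs.∷ !xs ,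
    cong suc |xs| ,
    λ b → mk⇔ (λ { (here b≡a) → inj₁ b≡a ; (there b∈xs) → inj₂ (to (∈⇔P b) b∈xs) })
              (λ { (inj₁ b≡a) → here b≡a ; (inj₂ Pb) → there (from (∈⇔P b) Pb) })
    where open Equivalence

module _ {A B : Set} where

  HasSize-map : ∀ {P : A → Set} {k} {f : A → B} → (∀ {a a′} → f a ≡ f a′ → a ≡ a′) →
                HasSize P k → HasSize (λ b → ∃ λ a → P a × b ≡ f a) k
  HasSize-map {f = f} f-inj (xs , !xs , |xs| , ∈⇔P) =
    map f xs , Unique.map⁺ f-inj !xs , trans (length-map f xs) |xs| ,
    λ b → mk⇔ (λ b∈ → let (a , a∈xs , b≡fa) = ∈-map⁻ f b∈ in a , to (∈⇔P a) a∈xs , b≡fa)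
              (λ { (a , Pa , refl) → ∈-map⁺ f (from (∈⇔P a) Pa) })
    where open Equivalence

injective⇒surjective : ∀ {n} {f : Fin n → Fin n} → (∀ {i j} → f i ≡ f j → i ≡ j) →
                       ∀ j → ∃ λ i → f i ≡ j
injective⇒surjective {suc n} {f} f-inj j with any? (λ i → f i ≟ᶠ j)
... | yes hit = hit
... | no miss =
  ⊥-elim (1+n≰n (injective⇒≤ (λ {i} {i′} → f-inj ∘ punchOut-injective (missed i) (missed i′))))
  where
  missed : ∀ i → j ≢ f i
  missed i j≡fi = miss (i , sym j≡fi)

-- Binary vectors and coordinate permutations

module _ {m : ℕ} where

  rep : Bool → BVec m
  rep = replicate m

  ≗⇒≡ : ∀ {u v : BVec m} → (∀ i → lookup u i ≡ lookup v i) → u ≡ v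
  ≗⇒≡ {u} {v} u≗v = trans (sym (tabulate∘lookup u)) (trans (tabulate-cong u≗v) (tabulate∘lookup v))

  lookup-⊕ : ∀ (u v : BVec m) i → lookup (u ⊕ v) i ≡ lookup u i xor lookup v i
  lookup-⊕ u v i = lookup-zipWith _xor_ i u v

  lookup-⊕-rep : ∀ (v : BVec m) b i → lookup (v ⊕ rep b) i ≡ lookup v i xor b
  lookup-⊕-rep v b i = trans (lookup-⊕ v (rep b) i) (cong (lookup v i xor_) (lookup-replicate i b))

  ⊕-assoc : ∀ (u v w : BVec m) → (u ⊕ v) ⊕ w ≡ u ⊕ (v ⊕ w)
  ⊕-assoc = zipWith-assoc xor-assoc

  ⊕-comm : ∀ (u v : BVec m) → u ⊕ v ≡ v ⊕ u
  ⊕-comm = zipWith-comm xor-comm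

  ⊕-identityʳ : ∀ (u : BVec m) → u ⊕ 𝟎 ≡ u
  ⊕-identityʳ = zipWith-identityʳ xor-identityʳ

  ⊕-identityˡ : ∀ (u : BVec m) → 𝟎 ⊕ u ≡ u
  ⊕-identityˡ u = trans (⊕-comm 𝟎 u) (⊕-identityʳ u)

  ⊕-self : ∀ (u : BVec m) → u ⊕ u ≡ 𝟎
  ⊕-self u = ≗⇒≡ λ i → trans (lookup-⊕ u u i) (trans (xor-same (lookup u i)) (sym (lookup-replicate i false)))

  ⊕-cancelʳ : ∀ (u v : BVec m) → (u ⊕ v) ⊕ v ≡ u
  ⊕-cancelʳ u v = trans (⊕-assoc u v v) (trans (cong (u ⊕_) (⊕-self v)) (⊕-identityʳ u))

  ⊕-cancelˡ : ∀ (u v w : BVec m) → u ⊕ v ≡ u ⊕ w → v ≡ w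
  ⊕-cancelˡ u v w eq = begin
    v             ≡⟨ sym (⊕-cancelʳ v u) ⟩
    (v ⊕ u) ⊕ u   ≡⟨ cong (_⊕ u) (trans (⊕-comm v u) (trans eq (⊕-comm u w))) ⟩
    (w ⊕ u) ⊕ u   ≡⟨ ⊕-cancelʳ w u ⟩
    w             ∎
    where open ≡-Reasoning

  rep-⊕ : ∀ b c → rep b ⊕ rep c ≡ rep (b xor c)
  rep-⊕ = zipWith-replicate _xor_

  infix 4 _∼_
  _∼_ : BVec m → BVec m → Set
  u ∼ v = ∃ λ b → u ≡ v ⊕ rep b

  ∼-sym : ∀ {u v} → u ∼ v → v ∼ u
  ∼-sym {v = v} (b , refl) = b , sym (⊕-cancelʳ v (rep b))

  ∼-trans : ∀ {u v w} → u ∼ v → v ∼ w → u ∼ w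
  ∼-trans {w = w} (b , refl) (c , refl) =
    c xor b , trans (⊕-assoc w (rep c) (rep b)) (cong (w ⊕_) (rep-⊕ c b))

  ∼𝟎⇒𝟎⊎𝟏 : ∀ {u} → u ∼ 𝟎 → u ≡ 𝟎 ⊎ u ≡ 𝟏
  ∼𝟎⇒𝟎⊎𝟏 (false , refl) = inj₁ (⊕-identityʳ 𝟎)
  ∼𝟎⇒𝟎⊎𝟏 (true , refl) = inj₂ (⊕-identityˡ 𝟏)

  ⊕-∼𝟎 : ∀ {u v} → v ∼ 𝟎 → u ⊕ v ∼ u
  ⊕-∼𝟎 {u} (c , refl) = c , cong (u ⊕_) (⊕-identityˡ (rep c))

  ∼⇒⊕∼𝟎 : ∀ {u v} → u ∼ v → u ⊕ v ∼ 𝟎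
  ∼⇒⊕∼𝟎 {v = v} (b , refl) = b , (begin
    (v ⊕ rep b) ⊕ v   ≡⟨ ⊕-comm (v ⊕ rep b) v ⟩
    v ⊕ (v ⊕ rep b)   ≡⟨ sym (⊕-assoc v v (rep b)) ⟩
    (v ⊕ v) ⊕ rep b   ≡⟨ cong (_⊕ rep b) (⊕-self v) ⟩
    𝟎 ⊕ rep b         ∎)
    where open ≡-Reasoning

  module _ (p : Permutation′ m) where

    lookup-act : ∀ v i → lookup (act p v) i ≡ lookup v (p ⟨$⟩ˡ i)
    lookup-act v = lookup∘tabulate _

    act-⊕ : ∀ u v → act p (u ⊕ v) ≡ act p u ⊕ act p v
    act-⊕ u v = ≗⇒≡ λ i → begin
      lookup (act p (u ⊕ v)) i                    ≡⟨ lookup-act (u ⊕ v) i ⟩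
      lookup (u ⊕ v) (p ⟨$⟩ˡ i)                   ≡⟨ lookup-⊕ u v _ ⟩
      lookup u (p ⟨$⟩ˡ i) xor lookup v (p ⟨$⟩ˡ i) ≡⟨ sym (cong₂ _xor_ (lookup-act u i) (lookup-act v i)) ⟩
      lookup (act p u) i xor lookup (act p v) i   ≡⟨ sym (lookup-⊕ (act p u) (act p v) i) ⟩
      lookup (act p u ⊕ act p v) i                ∎
      where open ≡-Reasoning

    act-rep : ∀ b → act p (rep b) ≡ rep b
    act-rep b = ≗⇒≡ λ i →
      trans (lookup-act (rep b) i) (trans (lookup-replicate (p ⟨$⟩ˡ i) b) (sym (lookup-replicate i b)))

    act-injective : ∀ {u v} → act p u ≡ act p v → u ≡ v
    act-injective {u} {v} eq = ≗⇒≡ λ i → begin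
      lookup u i                    ≡⟨ cong (lookup u) (sym (inverseˡ p)) ⟩
      lookup u (p ⟨$⟩ˡ (p ⟨$⟩ʳ i))  ≡⟨ sym (lookup-act u _) ⟩
      lookup (act p u) (p ⟨$⟩ʳ i)   ≡⟨ cong (λ w → lookup w (p ⟨$⟩ʳ i)) eq ⟩
      lookup (act p v) (p ⟨$⟩ʳ i)   ≡⟨ lookup-act v _ ⟩
      lookup v (p ⟨$⟩ˡ (p ⟨$⟩ʳ i))  ≡⟨ cong (lookup v) (inverseˡ p) ⟩
      lookup v i                    ∎
      where open ≡-Reasoning

  act-identity : ∀ (p : Permutation′ m) → (∀ i → p ⟨$⟩ʳ i ≡ i) → ∀ v → act p v ≡ v
  act-identity p p≗id v = ≗⇒≡ λ i →
    trans (lookup-act p v i) (cong (lookup v) (trans (sym (p≗id (p ⟨$⟩ˡ i))) (inverseʳ p)))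

  act-∘ : ∀ (p q r : Permutation′ m) → (∀ i → p ⟨$⟩ʳ (q ⟨$⟩ʳ i) ≡ r ⟨$⟩ʳ i) →
          ∀ v → act p (act q v) ≡ act r v
  act-∘ p q r pq≗r v = ≗⇒≡ λ i → begin
    lookup (act p (act q v)) i     ≡⟨ lookup-act p (act q v) i ⟩
    lookup (act q v) (p ⟨$⟩ˡ i)    ≡⟨ lookup-act q v _ ⟩
    lookup v (q ⟨$⟩ˡ (p ⟨$⟩ˡ i))   ≡⟨ cong (lookup v) (inverse-∘ i) ⟩
    lookup v (r ⟨$⟩ˡ i)            ≡⟨ sym (lookup-act r v i) ⟩
    lookup (act r v) i             ∎
    where
    open ≡-Reasoning
    inverse-∘ : ∀ i → q ⟨$⟩ˡ (p ⟨$⟩ˡ i) ≡ r ⟨$⟩ˡ i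
    inverse-∘ i = trans (sym (inverseˡ r)) (cong (r ⟨$⟩ˡ_)
      (trans (sym (pq≗r _)) (trans (cong (p ⟨$⟩ʳ_) (inverseʳ q)) (inverseʳ p))))

-- Sign sums and weights

zeros : ∀ {m} → BVec m → ℕ
zeros = count (_≟ᵇ false)

zeros-HasSize : ∀ {m} (v : BVec m) → HasSize (λ i → lookup v i ≡ false) (zeros v)
zeros-HasSize [] = [] , AllPairs.[] , refl , λ ()
zeros-HasSize (false ∷ v) =
  HasSize-cong head-zero (HasSize-∷ (λ { (_ , _ , ()) }) (HasSize-map suc-injective (zeros-HasSize v)))
  where
  head-zero : ∀ j → (j ≡ zero ⊎ ∃ λ i → lookup v i ≡ false × j ≡ suc i) ⇔ lookup (false ∷ v) j ≡ false
  head-zero zero = mk⇔ (λ _ → refl) (λ _ → inj₁ refl)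
  head-zero (suc j) = mk⇔ (λ { (inj₂ (_ , vj≡0 , refl)) → vj≡0 }) (λ vj≡0 → inj₂ (j , vj≡0 , refl))
zeros-HasSize (true ∷ v) = HasSize-cong head-one (HasSize-map suc-injective (zeros-HasSize v))
  where
  head-one : ∀ j → (∃ λ i → lookup v i ≡ false × j ≡ suc i) ⇔ lookup (true ∷ v) j ≡ false
  head-one zero = mk⇔ (λ { (_ , _ , ()) }) (λ ())
  head-one (suc j) = mk⇔ (λ { (_ , vj≡0 , refl) → vj≡0 }) (λ vj≡0 → j , vj≡0 , refl)

sgn : Bool → ℤ
sgn false = 1ℤ
sgn true = -1ℤ

Balanced : ∀ {m} → BVec m → Set
Balanced v = ∑ (λ i → sgn (lookup v i)) ≡ 0ℤ

∑-cong : ∀ {m} {f g : Fin m → ℤ} → (∀ i → f i ≡ g i) → ∑ f ≡ ∑ g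
∑-cong {zero} f≗g = refl
∑-cong {suc m} f≗g = cong₂ _+ℤ_ (f≗g zero) (∑-cong (f≗g ∘ suc))

∑-neg : ∀ {m} (f : Fin m → ℤ) → ∑ (λ i → - f i) ≡ - ∑ f
∑-neg {zero} f = refl
∑-neg {suc m} f = trans (cong (- f zero +ℤ_) (∑-neg (f ∘ suc))) (sym (ℤ.neg-distrib-+ (f zero) _))

∑-sgn : ∀ {m} (v : BVec m) → ∑ (λ i → sgn (lookup v i)) +ℤ + m ≡ + zeros v +ℤ + zeros v
∑-sgn [] = refl
∑-sgn {suc m} (false ∷ v) = begin
  (1ℤ +ℤ ∑ (λ i → sgn (lookup v i))) +ℤ (1ℤ +ℤ + m)   ≡⟨ shift (∑ (λ i → sgn (lookup v i))) (+ m) ⟩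
  (∑ (λ i → sgn (lookup v i)) +ℤ + m) +ℤ (1ℤ +ℤ 1ℤ)   ≡⟨ cong (_+ℤ (1ℤ +ℤ 1ℤ)) (∑-sgn v) ⟩
  (+ zeros v +ℤ + zeros v) +ℤ (1ℤ +ℤ 1ℤ)               ≡⟨ sym (shift (+ zeros v) (+ zeros v)) ⟩
  (1ℤ +ℤ + zeros v) +ℤ (1ℤ +ℤ + zeros v)               ∎
  where
  open ≡-Reasoning
  shift : ∀ a b → (1ℤ +ℤ a) +ℤ (1ℤ +ℤ b) ≡ (a +ℤ b) +ℤ (1ℤ +ℤ 1ℤ)
  shift = solve-∀
∑-sgn {suc m} (true ∷ v) = trans (cancel (∑ (λ i → sgn (lookup v i))) (+ m)) (∑-sgn v)
  where
  cancel : ∀ a b → (-1ℤ +ℤ a) +ℤ (1ℤ +ℤ b) ≡ a +ℤ b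
  cancel = solve-∀

Balanced⇒zeros : ∀ {m} {v : BVec m} → Balanced v → zeros v + zeros v ≡ m
Balanced⇒zeros {m} {v} bal = sym (ℤ.+-injective (trans (cong (_+ℤ + m) (sym bal)) (∑-sgn v)))

Balanced-∼ : ∀ {m} {u v : BVec m} → u ∼ v → Balanced v → Balanced u
Balanced-∼ {v = v} (false , refl) bal = subst Balanced (sym (⊕-identityʳ v)) bal
Balanced-∼ {v = v} (true , refl) bal = begin
  ∑ (λ i → sgn (lookup (v ⊕ 𝟏) i))   ≡⟨ ∑-cong (λ i → trans (cong sgn (lookup-⊕-rep v true i)) (sgn-flip _)) ⟩
  ∑ (λ i → - sgn (lookup v i))       ≡⟨ ∑-neg (λ i → sgn (lookup v i)) ⟩
  - ∑ (λ i → sgn (lookup v i))       ≡⟨ cong -_ bal ⟩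
  0ℤ                                 ∎
  where
  open ≡-Reasoning
  sgn-flip : ∀ b → sgn (b xor true) ≡ - sgn b
  sgn-flip false = refl
  sgn-flip true = refl

𝟎-unbalanced : ∀ {m} → Fin m → ¬ Balanced (𝟎 {m})
𝟎-unbalanced {suc m} _ bal =
  m+1+n≢m (suc m) (subst (λ k → k + k ≡ suc m) (zeros-𝟎 (suc m)) (Balanced⇒zeros {v = 𝟎} bal))
  where
  zeros-𝟎 : ∀ k → zeros (𝟎 {k}) ≡ k
  zeros-𝟎 zero = refl
  zeros-𝟎 (suc k) = cong suc (zeros-𝟎 k)

-- Hadamard codes

module HadamardRows {m} (H : Fin m → Fin m → ℤ) (isH : IsHadamardMatrix H) where

  row : Fin m → BVec m
  row = binRow H

  sgn-xor : ∀ a b → sgn (a xor b) ≡ sgn a *ℤ sgn b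
  sgn-xor false false = refl
  sgn-xor false true = refl
  sgn-xor true false = refl
  sgn-xor true true = refl

  sgn-toBit : ∀ {h} → h ≡ 1ℤ ⊎ h ≡ -1ℤ → sgn (toBit h) ≡ h
  sgn-toBit (inj₁ refl) = refl
  sgn-toBit (inj₂ refl) = refl

  sgn-row-⊕ : ∀ i j k → sgn (lookup (row i ⊕ row j) k) ≡ H i k *ℤ H j k
  sgn-row-⊕ i j k = begin
    sgn (lookup (row i ⊕ row j) k)               ≡⟨ cong sgn (lookup-⊕ (row i) (row j) k) ⟩
    sgn (lookup (row i) k xor lookup (row j) k)  ≡⟨ cong₂ (λ a b → sgn (a xor b)) (lookup-row i) (lookup-row j) ⟩
    sgn (toBit (H i k) xor toBit (H j k))        ≡⟨ sgn-xor (toBit (H i k)) (toBit (H j k)) ⟩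
    sgn (toBit (H i k)) *ℤ sgn (toBit (H j k))   ≡⟨ cong₂ _*ℤ_ (sgn-toBit (±1 i k)) (sgn-toBit (±1 j k)) ⟩
    H i k *ℤ H j k                               ∎
    where
    open ≡-Reasoning
    ±1 = proj₁ isH
    lookup-row : ∀ l → lookup (row l) k ≡ toBit (H l k)
    lookup-row l = lookup∘tabulate _ k

  rows-Balanced : ∀ {i j} → i ≢ j → Balanced (row i ⊕ row j)
  rows-Balanced {i} {j} i≢j = begin
    ∑ (λ k → sgn (lookup (row i ⊕ row j) k))   ≡⟨ ∑-cong (sgn-row-⊕ i j) ⟩
    ∑ (λ k → H i k *ℤ H j k)                   ≡⟨ proj₂ isH i j ⟩
    (if does (i ≟ᶠ j) then + m else 0ℤ)        ≡⟨ cong (if_then + m else 0ℤ) (dec-false (i ≟ᶠ j) i≢j) ⟩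
    0ℤ                                         ∎
    where open ≡-Reasoning

  rows-separated : ∀ {i j} → row i ∼ row j → i ≡ j
  rows-separated {i} {j} rowi∼rowj with i ≟ᶠ j
  ... | yes i≡j = i≡j
  ... | no i≢j = ⊥-elim (𝟎-unbalanced i (Balanced-∼ (∼-sym (∼⇒⊕∼𝟎 rowi∼rowj)) (rows-Balanced i≢j)))

-- HFP-codes

module HFPCode {m} (f₀ : Fin m) {C : BVec m → Set} {π : BVec m → Permutation′ m} (hfp : IsHFP C π) where

  open IsHFP hfp
  open IsPropelinear propelinear
  open HadamardRows (proj₁ hadamard) (proj₁ (proj₂ hadamard))
  open Equivalence

  C⇔∼row : ∀ v → C v ⇔ (∃ λ i → v ∼ row i)
  C⇔∼row v = mk⇔ (from-code ∘ to (code v)) (from (code v) ∘ to-code)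
    where
    code = proj₂ (proj₂ hadamard)
    from-code : (∃ λ i → v ≡ row i ⊎ v ≡ row i ⊕ 𝟏) → ∃ λ i → v ∼ row i
    from-code (i , inj₁ v≡row) = i , false , trans v≡row (sym (⊕-identityʳ (row i)))
    from-code (i , inj₂ v≡row⊕𝟏) = i , true , v≡row⊕𝟏
    to-code : (∃ λ i → v ∼ row i) → ∃ λ i → v ≡ row i ⊎ v ≡ row i ⊕ 𝟏
    to-code (i , false , v≡row⊕𝟎) = i , inj₁ (trans v≡row⊕𝟎 (⊕-identityʳ (row i)))
    to-code (i , true , v≡row⊕𝟏) = i , inj₂ v≡row⊕𝟏

  rowIndex : ∀ {v} → C v → Fin m
  rowIndex {v} c = proj₁ (to (C⇔∼row v) c)

  ∼-row-rowIndex : ∀ {v} (c : C v) → v ∼ row (rowIndex c)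
  ∼-row-rowIndex {v} c = proj₂ (to (C⇔∼row v) c)

  C-∼ : ∀ {u v} → C v → u ∼ v → C u
  C-∼ {u} c u∼v = from (C⇔∼row u) (rowIndex c , ∼-trans u∼v (∼-row-rowIndex c))

  row∈C : ∀ i → C (row i)
  row∈C i = from (C⇔∼row (row i)) (i , false , sym (⊕-identityʳ (row i)))

  𝟏∈C : C 𝟏
  𝟏∈C = C-∼ zero∈ (true , sym (⊕-identityˡ 𝟏))

  -- With w ∼ row i and 𝟎 ∼ row r, w is equal up to complement to row i ⊕ row r, which is 𝟎 if i = r.
  codeword-Balanced : ∀ {w} → C w → w ≢ 𝟎 → w ≢ 𝟏 → Balanced w
  codeword-Balanced {w} cw w≢𝟎 w≢𝟏 = by-cases (i ≟ᶠ r)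
    where
    i = rowIndex cw
    r = rowIndex zero∈
    w∼rowi⊕rowr : w ∼ row i ⊕ row r
    w∼rowi⊕rowr = ∼-trans (∼-row-rowIndex cw) (∼-sym (⊕-∼𝟎 (∼-sym (∼-row-rowIndex zero∈))))
    by-cases : Dec (i ≡ r) → Balanced w
    by-cases (yes i≡r) = ⊥-elim ([ w≢𝟎 , w≢𝟏 ]′ (∼𝟎⇒𝟎⊎𝟏 (subst (w ∼_) rowi⊕rowr≡𝟎 w∼rowi⊕rowr)))
      where
      rowi⊕rowr≡𝟎 : row i ⊕ row r ≡ 𝟎
      rowi⊕rowr≡𝟎 = trans (cong (λ k → row i ⊕ row k) (sym i≡r)) (⊕-self (row i))
    by-cases (no i≢r) = Balanced-∼ w∼rowi⊕rowr (rows-Balanced i≢r)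

  codeword-zeros : ∀ {w} → C w → w ≢ 𝟎 → w ≢ 𝟏 → zeros w + zeros w ≡ m
  codeword-zeros {w} cw w≢𝟎 w≢𝟏 = Balanced⇒zeros {v = w} (codeword-Balanced cw w≢𝟎 w≢𝟏)

  infixl 7 _·_
  _·_ : BVec m → BVec m → BVec m
  _·_ = mul π

  lookup-· : ∀ x y i → lookup (x · y) i ≡ lookup x i xor lookup y (π x ⟨$⟩ˡ i)
  lookup-· x y i = trans (lookup-⊕ x (act (π x) y) i) (cong (lookup x i xor_) (lookup-act (π x) y i))

  ·-identityʳ : ∀ x → x · 𝟎 ≡ x
  ·-identityʳ x = trans (cong (x ⊕_) (act-rep (π x) false)) (⊕-identityʳ x)

  ·-identityˡ : ∀ x → 𝟎 · x ≡ x
  ·-identityˡ x = trans (cong (𝟎 ⊕_) (act-identity (π 𝟎) π𝟎 x)) (⊕-identityˡ x)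

  ·𝟏 : ∀ x → x · 𝟏 ≡ x ⊕ 𝟏
  ·𝟏 x = cong (x ⊕_) (act-rep (π x) true)

  𝟏· : ∀ x → 𝟏 · x ≡ x ⊕ 𝟏
  𝟏· x = trans (cong (𝟏 ⊕_) (act-identity (π 𝟏) π𝟏 x)) (⊕-comm 𝟏 x)

  ·-⊕-rep : ∀ x v b → x · (v ⊕ rep b) ≡ (x · v) ⊕ rep b
  ·-⊕-rep x v b = begin
    x ⊕ act (π x) (v ⊕ rep b)         ≡⟨ cong (x ⊕_) (act-⊕ (π x) v (rep b)) ⟩
    x ⊕ (act (π x) v ⊕ act (π x) (rep b)) ≡⟨ cong (λ w → x ⊕ (act (π x) v ⊕ w)) (act-rep (π x) b) ⟩
    x ⊕ (act (π x) v ⊕ rep b)         ≡⟨ sym (⊕-assoc x (act (π x) v) (rep b)) ⟩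
    (x · v) ⊕ rep b                   ∎
    where open ≡-Reasoning

  ·-assoc : ∀ {x y z} → C x → C y → C z → (x · y) · z ≡ x · (y · z)
  ·-assoc {x} {y} {z} cx cy cz = begin
    (x ⊕ act (π x) y) ⊕ act (π (x · y)) z        ≡⟨ ⊕-assoc x (act (π x) y) _ ⟩
    x ⊕ (act (π x) y ⊕ act (π (x · y)) z)        ≡⟨ cong (λ v → x ⊕ (act (π x) y ⊕ v)) (sym π-∘) ⟩
    x ⊕ (act (π x) y ⊕ act (π x) (act (π y) z))  ≡⟨ cong (x ⊕_) (sym (act-⊕ (π x) y (act (π y) z))) ⟩
    x ⊕ act (π x) (y · z)                        ∎
    where
    open ≡-Reasoning
    π-∘ = act-∘ (π x) (π y) (π (x · y)) (hom cx cy) z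

  ·-cancelˡ : ∀ x {y y′} → x · y ≡ x · y′ → y ≡ y′
  ·-cancelˡ x = act-injective (π x) ∘ ⊕-cancelˡ x _ _

  ·-reflects-∼ : ∀ x {u v} → x · u ∼ x · v → u ∼ v
  ·-reflects-∼ x {v = v} (b , xu≡xv⊕b) = b , ·-cancelˡ x (trans xu≡xv⊕b (sym (·-⊕-rep x v b)))

  -- x · _ induces an injective, hence surjective, map on the complementary pairs {row i, row i ⊕ 𝟏};
  -- the pair sent to {𝟎, 𝟏} contains a right inverse of x.
  ·-inverseʳ : ∀ {x} → C x → ∃ λ y → C y × x · y ≡ 𝟎
  ·-inverseʳ {x} cx with injective⇒surjective image-injective (rowIndex zero∈)
    where
    image : Fin m → Fin m
    image i = rowIndex (closed cx (row∈C i))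
    image-injective : ∀ {i j} → image i ≡ image j → i ≡ j
    image-injective {i} {j} eq = rows-separated (·-reflects-∼ x
      (∼-trans (∼-row-rowIndex (closed cx (row∈C i)))
        (subst (λ k → row k ∼ x · row j) (sym eq) (∼-sym (∼-row-rowIndex (closed cx (row∈C j)))))))
  ... | i , eq = row i ⊕ rep b , C-∼ (row∈C i) (b , refl) , (begin
    x · (row i ⊕ rep b)   ≡⟨ ·-⊕-rep x (row i) b ⟩
    (x · row i) ⊕ rep b   ≡⟨ cong (_⊕ rep b) xrowi≡b ⟩
    (𝟎 ⊕ rep b) ⊕ rep b   ≡⟨ ⊕-cancelʳ 𝟎 (rep b) ⟩
    𝟎                     ∎)
    where
    open ≡-Reasoning
    xrowi∼𝟎 : x · row i ∼ 𝟎
    xrowi∼𝟎 = ∼-trans (∼-row-rowIndex (closed cx (row∈C i)))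
      (subst (λ k → row k ∼ 𝟎) (sym eq) (∼-sym (∼-row-rowIndex zero∈)))
    b = proj₁ xrowi∼𝟎
    xrowi≡b = proj₂ xrowi∼𝟎

  record Inverse (x : BVec m) : Set where
    field
      x⁻¹ : BVec m
      x⁻¹∈C : C x⁻¹
      x·x⁻¹≡𝟎 : x · x⁻¹ ≡ 𝟎
      x⁻¹·x≡𝟎 : x⁻¹ · x ≡ 𝟎

  inverse : ∀ {x} → C x → Inverse x
  inverse {x} cx = record { x⁻¹ = y ; x⁻¹∈C = cy ; x·x⁻¹≡𝟎 = xy≡𝟎 ; x⁻¹·x≡𝟎 = yx≡𝟎 }
    where
    open ≡-Reasoning
    y = proj₁ (·-inverseʳ cx)
    cy = proj₁ (proj₂ (·-inverseʳ cx))
    xy≡𝟎 = proj₂ (proj₂ (·-inverseʳ cx))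
    z = proj₁ (·-inverseʳ cy)
    cz = proj₁ (proj₂ (·-inverseʳ cy))
    yz≡𝟎 = proj₂ (proj₂ (·-inverseʳ cy))
    yx≡𝟎 : y · x ≡ 𝟎
    yx≡𝟎 = begin
      y · x                 ≡⟨ sym (·-identityʳ (y · x)) ⟩
      (y · x) · 𝟎           ≡⟨ cong ((y · x) ·_) (sym yz≡𝟎) ⟩
      (y · x) · (y · z)     ≡⟨ ·-assoc cy cx (closed cy cz) ⟩
      y · (x · (y · z))     ≡⟨ cong (y ·_) (sym (·-assoc cx cy cz)) ⟩
      y · ((x · y) · z)     ≡⟨ cong (λ v → y · (v · z)) xy≡𝟎 ⟩
      y · (𝟎 · z)           ≡⟨ cong (y ·_) (·-identityˡ z) ⟩
      y · z                 ≡⟨ yz≡𝟎 ⟩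
      𝟎                     ∎

  D : BVec m → Set
  D z = C z × lookup z f₀ ≡ false

  module _ {x} (cx : C x) where
    open Inverse (inverse cx)

    ·x·x⁻¹ : ∀ {s} → C s → (s · x) · x⁻¹ ≡ s
    ·x·x⁻¹ {s} cs = trans (·-assoc cs cx x⁻¹∈C) (trans (cong (s ·_) x·x⁻¹≡𝟎) (·-identityʳ s))

    ·x⁻¹·x : ∀ {s} → C s → (s · x⁻¹) · x ≡ s
    ·x⁻¹·x {s} cs = trans (·-assoc cs x⁻¹∈C cx) (trans (cong (s ·_) x⁻¹·x≡𝟎) (·-identityʳ s))

    π-x⁻¹ : ∀ i → π x⁻¹ ⟨$⟩ʳ i ≡ π x ⟨$⟩ˡ i
    π-x⁻¹ i = begin
      π x⁻¹ ⟨$⟩ʳ i                        ≡⟨ sym (inverseˡ (π x)) ⟩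
      π x ⟨$⟩ˡ (π x ⟨$⟩ʳ (π x⁻¹ ⟨$⟩ʳ i))  ≡⟨ cong (π x ⟨$⟩ˡ_) (hom cx x⁻¹∈C i) ⟩
      π x ⟨$⟩ˡ (π (x · x⁻¹) ⟨$⟩ʳ i)       ≡⟨ cong (λ v → π x ⟨$⟩ˡ (π v ⟨$⟩ʳ i)) x·x⁻¹≡𝟎 ⟩
      π x ⟨$⟩ˡ (π 𝟎 ⟨$⟩ʳ i)               ≡⟨ cong (π x ⟨$⟩ˡ_) (π𝟎 i) ⟩
      π x ⟨$⟩ˡ i                          ∎
      where open ≡-Reasoning

    x⁻¹≢𝟎 : x ≢ 𝟎 → x⁻¹ ≢ 𝟎
    x⁻¹≢𝟎 x≢𝟎 x⁻¹≡𝟎 = x≢𝟎 (trans (sym (·-identityʳ x)) (trans (cong (x ·_) (sym x⁻¹≡𝟎)) x·x⁻¹≡𝟎))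

    x⁻¹≢𝟏 : x ≢ 𝟏 → x⁻¹ ≢ 𝟏
    x⁻¹≢𝟏 x≢𝟏 x⁻¹≡𝟏 = x≢𝟏 (begin
      x               ≡⟨ sym (⊕-cancelʳ x 𝟏) ⟩
      (x ⊕ 𝟏) ⊕ 𝟏     ≡⟨ cong (_⊕ 𝟏) (sym (·𝟏 x)) ⟩
      (x · 𝟏) ⊕ 𝟏     ≡⟨ cong (λ v → (x · v) ⊕ 𝟏) (sym x⁻¹≡𝟏) ⟩
      (x · x⁻¹) ⊕ 𝟏   ≡⟨ cong (_⊕ 𝟏) x·x⁻¹≡𝟎 ⟩
      𝟎 ⊕ 𝟏           ≡⟨ ⊕-identityˡ 𝟏 ⟩
      𝟏               ∎)
      where open ≡-Reasoning

    rightTranslate-D⇔ : ∀ {z} → C z → rightTranslate π D x z ⇔ lookup (z · x⁻¹) f₀ ≡ false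
    rightTranslate-D⇔ cz = mk⇔
      (λ { (s , (cs , s₀≡0) , refl) → subst (λ v → lookup v f₀ ≡ false) (sym (·x·x⁻¹ cs)) s₀≡0 })
      (λ bit≡0 → _ , (closed cz x⁻¹∈C , bit≡0) , sym (·x⁻¹·x cz))

  fixes-coordinate⇒𝟎⊎𝟏 : ∀ {u} → C u → ∀ i → π u ⟨$⟩ʳ i ≡ i → u ≡ 𝟎 ⊎ u ≡ 𝟏
  fixes-coordinate⇒𝟎⊎𝟏 {u} cu i fixed with ≡-dec _≟ᵇ_ u 𝟎 | ≡-dec _≟ᵇ_ u 𝟏
  ... | yes u≡𝟎 | _ = inj₁ u≡𝟎
  ... | no _ | yes u≡𝟏 = inj₂ u≡𝟏
  ... | no u≢𝟎 | no u≢𝟏 = ⊥-elim (fixedPointFree cu u≢𝟎 u≢𝟏 i fixed)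

  firstPreimage : BVec m → Fin m
  firstPreimage z = π z ⟨$⟩ˡ f₀

  lookup-·-first : ∀ {z} → D z → ∀ y → lookup (z · y) f₀ ≡ lookup y (firstPreimage z)
  lookup-·-first {z} (_ , z₀≡0) y = trans (lookup-· z y f₀) (cong (_xor lookup y (firstPreimage z)) z₀≡0)

  -- t · z⁻¹ fixes the first coordinate, and 𝟏 · z is not in D.
  firstPreimage-injective : ∀ {z t} → D z → D t → firstPreimage z ≡ firstPreimage t → z ≡ t
  firstPreimage-injective {z} {t} (cz , z₀≡0) (ct , t₀≡0) same =
    [ u≡𝟎⇒z≡t , ⊥-elim ∘ u≢𝟏 ]′ (fixes-coordinate⇒𝟎⊎𝟏 (closed ct x⁻¹∈C) f₀ u-fixes-f₀)
    where
    open Inverse (inverse cz)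
    open ≡-Reasoning
    u-fixes-f₀ : π (t · x⁻¹) ⟨$⟩ʳ f₀ ≡ f₀
    u-fixes-f₀ = begin
      π (t · x⁻¹) ⟨$⟩ʳ f₀        ≡⟨ sym (hom ct x⁻¹∈C f₀) ⟩
      π t ⟨$⟩ʳ (π x⁻¹ ⟨$⟩ʳ f₀)   ≡⟨ cong (π t ⟨$⟩ʳ_) (trans (π-x⁻¹ cz f₀) same) ⟩
      π t ⟨$⟩ʳ (π t ⟨$⟩ˡ f₀)     ≡⟨ inverseʳ (π t) ⟩
      f₀                         ∎
    u≡𝟎⇒z≡t : t · x⁻¹ ≡ 𝟎 → z ≡ t
    u≡𝟎⇒z≡t u≡𝟎 = sym (begin
      t               ≡⟨ sym (·x⁻¹·x cz ct) ⟩
      (t · x⁻¹) · z   ≡⟨ cong (_· z) u≡𝟎 ⟩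
      𝟎 · z           ≡⟨ ·-identityˡ z ⟩
      z               ∎)
    u≢𝟏 : t · x⁻¹ ≢ 𝟏
    u≢𝟏 u≡𝟏 = not-¬ t₀≡1 t₀≡0
      where
      t₀≡1 : lookup t f₀ ≡ true
      t₀≡1 = begin
        lookup t f₀                 ≡⟨ cong (λ v → lookup v f₀) (sym (·x⁻¹·x cz ct)) ⟩
        lookup ((t · x⁻¹) · z) f₀   ≡⟨ cong (λ v → lookup (v · z) f₀) u≡𝟏 ⟩
        lookup (𝟏 · z) f₀           ≡⟨ cong (λ v → lookup v f₀) (𝟏· z) ⟩
        lookup (z ⊕ 𝟏) f₀           ≡⟨ lookup-⊕-rep z true f₀ ⟩
        lookup z f₀ xor true        ≡⟨ cong (_xor true) z₀≡0 ⟩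
        true                        ∎

  normalise : Fin m → BVec m
  normalise i = row i ⊕ rep (lookup (row i) f₀)

  normalise-∼ : ∀ i → normalise i ∼ row i
  normalise-∼ i = _ , refl

  normalise∈D : ∀ i → D (normalise i)
  normalise∈D i = C-∼ (row∈C i) (normalise-∼ i) , trans (lookup-⊕-rep (row i) _ f₀) (xor-same (lookup (row i) f₀))

  normalise-injective : ∀ {i j} → normalise i ≡ normalise j → i ≡ j
  normalise-injective {i} {j} eq =
    rows-separated (∼-trans (∼-sym (normalise-∼ i)) (subst (_∼ row j) (sym eq) (normalise-∼ j)))

  firstPreimage-onto : ∀ j → ∃ λ z → D z × firstPreimage z ≡ j
  firstPreimage-onto j =
    let (i , eq) = injective⇒surjective σ-injective j in normalise i , normalise∈D i , eq
    where
    σ-injective : ∀ {i i′} → firstPreimage (normalise i) ≡ firstPreimage (normalise i′) → i ≡ i′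
    σ-injective = normalise-injective ∘ firstPreimage-injective (normalise∈D _) (normalise∈D _)

  module _ {x} (cx : C x) where
    open Inverse (inverse cx)

    D∩Dx-HasSize : HasSize (λ z → D z × rightTranslate π D x z) (zeros x⁻¹)
    D∩Dx-HasSize = HasSize-cong characterisation
      (HasSize-map {P = λ j → lookup x⁻¹ j ≡ false} {f = ψ} ψ-injective (zeros-HasSize x⁻¹))
      where
      ψ : Fin m → BVec m
      ψ j = proj₁ (firstPreimage-onto j)
      ψ∈D : ∀ j → D (ψ j)
      ψ∈D j = proj₁ (proj₂ (firstPreimage-onto j))
      firstPreimage-ψ : ∀ j → firstPreimage (ψ j) ≡ j
      firstPreimage-ψ j = proj₂ (proj₂ (firstPreimage-onto j))
      ψ-injective : ∀ {j j′} → ψ j ≡ ψ j′ → j ≡ j′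
      ψ-injective {j} {j′} eq = trans (sym (firstPreimage-ψ j)) (trans (cong firstPreimage eq) (firstPreimage-ψ j′))
      ψ∈D∩Dx : ∀ j → lookup x⁻¹ j ≡ false → D (ψ j) × rightTranslate π D x (ψ j)
      ψ∈D∩Dx j x⁻¹ⱼ≡0 = ψ∈D j , from (rightTranslate-D⇔ cx (proj₁ (ψ∈D j)))
        (trans (lookup-·-first (ψ∈D j) x⁻¹) (trans (cong (lookup x⁻¹) (firstPreimage-ψ j)) x⁻¹ⱼ≡0))
      characterisation : ∀ z → (∃ λ j → lookup x⁻¹ j ≡ false × z ≡ ψ j) ⇔ (D z × rightTranslate π D x z)
      characterisation z = mk⇔
        (λ (j , x⁻¹ⱼ≡0 , z≡ψj) → subst (λ v → D v × rightTranslate π D x v) (sym z≡ψj) (ψ∈D∩Dx j x⁻¹ⱼ≡0))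
        (λ (dz , z∈Dx) → firstPreimage z ,
          trans (sym (lookup-·-first dz x⁻¹)) (to (rightTranslate-D⇔ cx (proj₁ dz)) z∈Dx) ,
          firstPreimage-injective dz (ψ∈D _) (sym (firstPreimage-ψ _)))

    Dx∩pair-HasSize : ∀ {y} → C y → HasSize (λ z → rightTranslate π D x z × (z ≡ y ⊎ z ≡ y · 𝟏)) 1
    Dx∩pair-HasSize {y} cy = exactly-one (lookup (y · x⁻¹) f₀) refl
      where
      open ≡-Reasoning
      cy𝟏 = closed cy 𝟏∈C
      -- 𝟏 is central, so (y · 𝟏) · x⁻¹ is the complement of y · x⁻¹.
      y𝟏-bit : lookup ((y · 𝟏) · x⁻¹) f₀ ≡ not (lookup (y · x⁻¹) f₀)
      y𝟏-bit = begin
        lookup ((y · 𝟏) · x⁻¹) f₀      ≡⟨ cong (λ v → lookup v f₀) (·-assoc cy 𝟏∈C x⁻¹∈C) ⟩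
        lookup (y · (𝟏 · x⁻¹)) f₀      ≡⟨ cong (λ v → lookup (y · v) f₀) (𝟏· x⁻¹) ⟩
        lookup (y · (x⁻¹ ⊕ 𝟏)) f₀      ≡⟨ cong (λ v → lookup v f₀) (·-⊕-rep y x⁻¹ true) ⟩
        lookup ((y · x⁻¹) ⊕ 𝟏) f₀      ≡⟨ lookup-⊕-rep (y · x⁻¹) true f₀ ⟩
        lookup (y · x⁻¹) f₀ xor true   ≡⟨ xor-true (lookup (y · x⁻¹) f₀) ⟩
        not (lookup (y · x⁻¹) f₀)      ∎
        where
        xor-true : ∀ b → b xor true ≡ not b
        xor-true false = refl
        xor-true true = refl
      Pair : BVec m → Set
      Pair z = rightTranslate π D x z × (z ≡ y ⊎ z ≡ y · 𝟏)
      exactly-one : ∀ b → lookup (y · x⁻¹) f₀ ≡ b → HasSize Pair 1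
      exactly-one false y-bit = HasSize-witness {P = Pair} y
        (from (rightTranslate-D⇔ cx cy) y-bit , inj₁ refl) λ where
        z (_ , inj₁ z≡y) → z≡y
        z (z∈Dx , inj₂ z≡y𝟏) → ⊥-elim (not-¬ (trans y𝟏-bit (cong not y-bit))
          (to (rightTranslate-D⇔ cx cy𝟏) (subst (rightTranslate π D x) z≡y𝟏 z∈Dx)))
      exactly-one true y-bit = HasSize-witness {P = Pair} (y · 𝟏)
        (from (rightTranslate-D⇔ cx cy𝟏) (trans y𝟏-bit (cong not y-bit)) , inj₂ refl) λ where
        z (z∈Dx , inj₁ z≡y) → ⊥-elim (not-¬ y-bit
          (to (rightTranslate-D⇔ cx cy) (subst (rightTranslate π D x) z≡y z∈Dx)))
        z (_ , inj₂ z≡y𝟏) → z≡y𝟏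

k+k≡4n⇒k≡2n : ∀ k n → k + k ≡ 4 * n → k ≡ 2 * n
k+k≡4n⇒k≡2n k n k+k≡4n =
  *-cancelˡ-≡ k (2 * n) 2 (trans (cong (λ j → k + j) (+-identityʳ k)) (trans k+k≡4n (*-assoc 2 2 n)))

proposition3 : (n : ℕ) → {{_ : NonZero n}} →
    (C : BVec (4 * n) → Set) → (π : BVec (4 * n) → Permutation′ (4 * n)) →
    IsHFP C π →
    (∀ x → C x → x ≢ 𝟎 → x ≢ 𝟏 →
      HasSize (λ z → D₁ n C z × rightTranslate π (D₁ n C) x z) (2 * n)) ×
    (∀ x y → C x → C y →
      HasSize (λ z → rightTranslate π (D₁ n C) x z × (z ≡ y ⊎ z ≡ mul π y 𝟏)) 1)
proposition3 n C π hfp = D₁∩D₁x-size , λ _ _ cx → Dx∩pair-HasSize cx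
  where
  open HFPCode (first n) hfp
  D₁∩D₁x-size : ∀ x → C x → x ≢ 𝟎 → x ≢ 𝟏 → HasSize (λ z → D₁ n C z × rightTranslate π (D₁ n C) x z) (2 * n)
  D₁∩D₁x-size x cx x≢𝟎 x≢𝟏 = subst (HasSize _) half-weight (D∩Dx-HasSize cx)
    where
    open Inverse (inverse cx)
    half-weight : zeros x⁻¹ ≡ 2 * n
    half-weight = k+k≡4n⇒k≡2n _ n (codeword-zeros x⁻¹∈C (x⁻¹≢𝟎 cx x≢𝟎) (x⁻¹≢𝟏 cx x≢𝟏))
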